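{- Let $F$ be a finite family of intervals. Consider any run of the reduction procedure: $G_0=F$, and while $G_k$ has a bad interval, $G_{k+1}=G_k\downarrow s_k$ where $s_k$ is an arbitrary minimal bad interval for $G_k$, stopping at the first $G_r$ that has no bad interval. Then the final family $G_r$ is the same for all such runs, and the multiset $\{s_0,\dots,s_{r-1}\}$ of reduced intervals is also the same (up to order) for all such runs.
   Context: For integers $a<b$, $[a,b)=\{x\in\mathbb{Z}: a\le x<b\}$; an interval is a nonempty set of this form. A family is a finite set of intervals. For a set $s$, $F|s=\{f\in F: f\subseteq s\}$. For an integer $x$, $N_x F$ is the number of members of $F$ containing $x$. An interval $s$ is good for $F$ if $N_x(F|s)\le 1$ for some $x\in s$, and bad otherwise; a minimal bad interval is a bad interval containing no other bad interval. Given an interval $s$, let $[a_1,b_1),\dots,[a_k,b_k)$ be the inclusion-maximal members of $F|s$, ordered so that $a_1<\dots<a_k$ (then $b_1<\dots<b_k$). If $a_{j+1}<b_j$ for $1\le j<k$, define $F\downarrow s=(F\setminus\{[a_1,b_1),\dots,[a_k,b_k)\})\cup\{[a_2,b_1),\dots,[a_k,b_{k-1})\}$; this condition holds whenever $s$ is a minimal bad interval for $F$, so $F\downarrow s$ is then defined. -}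

module Defs where

open import Data.Integer using (ℤ; _≤_; _<_; _≤?_; _<?_; _≟_)
open import Data.Nat using (ℕ)
import Data.Nat as ℕ
open import Data.Product using (_×_; _,_; Σ; ∃; ∃-syntax; proj₁; proj₂)
open import Data.Product.Properties using (≡-dec)
open import Data.Sum using (_⊎_)
open import Data.List using (List; []; _∷_; filter; length; deduplicate)
open import Data.List.Membership.Propositional using (_∈_)
open import Function.Bundles using (_⇔_)
open import Relation.Nullary using (¬_; Dec)
open import Relation.Nullary.Decidable using (_×-dec_)
open import Relation.Binary.PropositionalEquality using (_≡_)
open import Relation.Binary.Definitions using (DecidableEquality)

-- An interval [a,b) is represented by the pair (a , b); it is an interval
-- (nonempty) iff a < b.
Interval : Set
Interval = ℤ × ℤ

left right : Interval → ℤ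
left = proj₁
right = proj₂

IsInterval : Interval → Set
IsInterval (a , b) = a < b

_≟ᵢ_ : DecidableEquality Interval
_≟ᵢ_ = ≡-dec _≟_ _≟_

_∈ᵢ_ : ℤ → Interval → Set
x ∈ᵢ (a , b) = (a ≤ x) × (x < b)

_∈ᵢ?_ : (x : ℤ) (i : Interval) → Dec (x ∈ᵢ i)
x ∈ᵢ? (a , b) = (a ≤? x) ×-dec (x <? b)

_⊆ᵢ_ : Interval → Interval → Set
(a , b) ⊆ᵢ (c , d) = (c ≤ a) × (b ≤ d)

_⊆ᵢ?_ : (i j : Interval) → Dec (i ⊆ᵢ j)
(a , b) ⊆ᵢ? (c , d) = (c ≤? a) ×-dec (b ≤? d)

-- A family is a finite set of intervals, represented by a list; only
-- membership matters (all notions below are invariant under duplicates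
-- and reordering).
Family : Set
Family = List Interval

WellFormed : Family → Set
WellFormed F = ∀ i → i ∈ F → IsInterval i

_≈F_ : Family → Family → Set
F ≈F G = ∀ i → (i ∈ F) ⇔ (i ∈ G)

_∣_ : Family → Interval → Family
F ∣ s = filter (λ f → f ⊆ᵢ? s) F

N : ℤ → Family → ℕ
N x F = length (deduplicate _≟ᵢ_ (filter (λ f → x ∈ᵢ? f) F))

Bad : Family → Interval → Set
Bad F s = IsInterval s × (∀ x → x ∈ᵢ s → 2 ℕ.≤ N x (F ∣ s))

Good : Family → Interval → Set
Good F s = IsInterval s × ∃[ x ] (x ∈ᵢ s × N x (F ∣ s) ℕ.≤ 1)

MinimalBad : Family → Interval → Set
MinimalBad F s = Bad F s × (∀ t → Bad F t → t ⊆ᵢ s → t ≡ s)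

HasBad : Family → Set
HasBad F = ∃[ s ] Bad F s

Maximal : Family → Interval → Interval → Set
Maximal F s m = m ∈ (F ∣ s) × (∀ f → f ∈ (F ∣ s) → m ⊆ᵢ f → f ≡ m)

Consecutive : Family → Interval → Interval → Interval → Set
Consecutive F s m₁ m₂ =
  Maximal F s m₁ × Maximal F s m₂ × (left m₁ < left m₂) ×
  (∀ m → Maximal F s m → ¬ ((left m₁ < left m) × (left m < left m₂)))

InReduce : Family → Interval → Interval → Set
InReduce F s i =
  (i ∈ F × ¬ Maximal F s i) ⊎
  (∃[ m₁ ] ∃[ m₂ ] (Consecutive F s m₁ m₂ × i ≡ (left m₂ , right m₁)))

IsReduce : Family → Interval → Family → Set
IsReduce F s G = ∀ i → (i ∈ G) ⇔ InReduce F s i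

data Run : Family → List Interval → Family → Set where
  stop : ∀ {G} → ¬ HasBad G → Run G [] G
  step : ∀ {G s G' ss H} → MinimalBad G s → IsReduce G s G' →
         Run G' ss H → Run G (s ∷ ss) H

-- Confluence in the manner of Newman's lemma: by induction on a run, every run can be reordered
-- to start with any minimal bad interval t, provided any two distinct minimal bad intervals s, t
-- of G commute: t stays minimal bad in G ↓ s, and (G ↓ s) ↓ t = (G ↓ t) ↓ s.
--
-- Commutation is proved by counting. Let D(j) say that j lies inside a member of G ∣ s. Reducing
-- removes the maximal members of G ∣ s (exactly the j with D(j) but neither one-step extension of
-- j in D) and adds the overlaps of consecutive ones (the j with both one-step extensions in D but
-- not the two-step one), so the indicator of G ↓ s is that of G plus a second difference of D.
-- Both double reductions are then G plus the second difference of a sum of two such D's, and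
-- these sums agree pointwise.

module Submission where

open import Defs
open import Data.Empty using (⊥; ⊥-elim)
open import Data.Integer as ℤ using (ℤ; _≤_; _<_; _≤?_; _<?_)
import Data.Integer.Properties as ℤP
open import Data.List using (List; []; _∷_; _++_; map; filter; length; deduplicate; cartesianProduct)
open import Data.List.Extrema ℤP.≤-totalOrder
  using (argmin; argmax; argmin-all; argmax-all; f[argmin]≤f[xs]; f[xs]≤f[argmax])
open import Data.List.Membership.DecPropositional _≟ᵢ_ using (_∈?_)
open import Data.List.Membership.Propositional using (_∈_; _∉_; find; lose)
open import Data.List.Membership.Propositional.Properties
  using (∈-filter⁺; ∈-filter⁻; ∈-deduplicate⁺; ∈-deduplicate⁻; ∈-++⁺ˡ; ∈-++⁺ʳ; ∈-++⁻; ∈-map⁺; ∈-map⁻;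
         ∈-cartesianProduct⁺)
open import Data.List.Relation.Binary.Permutation.Propositional using (_↭_; ↭-refl; ↭-trans; prep; swap)
open import Data.List.Relation.Unary.All as All using (all?)
open import Data.List.Relation.Unary.Any using (here; there; any?)
open import Data.Nat as ℕ using (ℕ; _+_; s≤s; z≤n)
import Data.Nat.Properties as ℕP
open import Data.Nat.Tactic.RingSolver using (solve-∀)
open import Data.Product using (_×_; _,_; ∃; ∃-syntax; proj₁; proj₂; uncurry)
open import Data.Sum using (_⊎_; inj₁; inj₂)
open import Function using (_∘_)
open import Function.Bundles using (_⇔_; mk⇔; Equivalence)
open import Function.Properties.Equivalence using () renaming (refl to ⇔-refl; sym to ⇔-sym; trans to ⇔-trans)
open import Relation.Binary.Definitions using (tri<; tri≈; tri>)
open import Relation.Binary.PropositionalEquality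
  using (_≡_; _≢_; refl; sym; trans; cong; cong₂; subst; subst₂; module ≡-Reasoning)
open import Relation.Nullary using (¬_; Dec; yes; no; ¬?)
open import Relation.Nullary.Decidable using (map′; _×-dec_; _→-dec_; decidable-stable)

interval-≡ : ∀ {i j : Interval} → left i ≡ left j → right i ≡ right j → i ≡ j
interval-≡ refl refl = refl

⊆ᵢ-refl : ∀ {i} → i ⊆ᵢ i
⊆ᵢ-refl = ℤP.≤-refl , ℤP.≤-refl

⊆ᵢ-trans : ∀ {i j k} → i ⊆ᵢ j → j ⊆ᵢ k → i ⊆ᵢ k
⊆ᵢ-trans (a , b) (c , d) = ℤP.≤-trans c a , ℤP.≤-trans b d

⊆ᵢ-antisym : ∀ {i j} → i ⊆ᵢ j → j ⊆ᵢ i → i ≡ j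
⊆ᵢ-antisym (a , b) (c , d) = interval-≡ (ℤP.≤-antisym c a) (ℤP.≤-antisym b d)

∈ᵢ-mono : ∀ {x i j} → x ∈ᵢ i → i ⊆ᵢ j → x ∈ᵢ j
∈ᵢ-mono (a , b) (c , d) = ℤP.≤-trans c a , ℤP.<-≤-trans b d

∈-∣⁺ : ∀ {F s f} → f ∈ F → f ⊆ᵢ s → f ∈ F ∣ s
∈-∣⁺ = ∈-filter⁺ (_⊆ᵢ? _)

∈-∣⁻ : ∀ {F s f} → f ∈ F ∣ s → f ∈ F × f ⊆ᵢ s
∈-∣⁻ {F} = ∈-filter⁻ (_⊆ᵢ? _) {xs = F}

record DoublyCovered (F : Family) (x : ℤ) : Set where
  constructor covered
  field
    {first second} : Interval
    first∈   : first ∈ F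
    second∈  : second ∈ F
    x∈first  : x ∈ᵢ first
    x∈second : x ∈ᵢ second
    distinct : first ≢ second

covered-mono : ∀ {F F' x} → (∀ {f} → f ∈ F → x ∈ᵢ f → f ∈ F') →
               DoublyCovered F x → DoublyCovered F' x
covered-mono into (covered f∈ g∈ xf xg f≢g) = covered (into f∈ xf) (into g∈ xg) xf xg f≢g

private
  2≤length : ∀ {L : List Interval} {f g} → f ∈ L → g ∈ L → f ≢ g → 2 ℕ.≤ length L
  2≤length {_ ∷ _ ∷ _} _ _ _ = s≤s (s≤s z≤n)
  2≤length {_ ∷ []} (here refl) (here refl) f≢g = ⊥-elim (f≢g refl)

  distinct-of-2≤length : ∀ L → 2 ℕ.≤ length (deduplicate _≟ᵢ_ L) →
                         ∃[ f ] ∃[ g ] f ∈ L × g ∈ L × f ≢ g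
  distinct-of-2≤length (f ∷ L) 2≤ with filter (¬? ∘ (f ≟ᵢ_)) (deduplicate _≟ᵢ_ L) in eq
  distinct-of-2≤length (f ∷ L) (s≤s ()) | []
  ... | g ∷ _ with ∈-filter⁻ (¬? ∘ (f ≟ᵢ_)) {xs = deduplicate _≟ᵢ_ L} (subst (g ∈_) (sym eq) (here refl))
  ...   | g∈ , f≢g = f , g , here refl , there (∈-deduplicate⁻ _≟ᵢ_ L g∈) , f≢g

2≤N⇒covered : ∀ {F x} → 2 ℕ.≤ N x F → DoublyCovered F x
2≤N⇒covered {F} {x} 2≤ with distinct-of-2≤length (filter (x ∈ᵢ?_) F) 2≤
... | f , g , f∈ , g∈ , f≢g with ∈-filter⁻ (x ∈ᵢ?_) f∈ | ∈-filter⁻ (x ∈ᵢ?_) g∈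
...   | f∈F , xf | g∈F , xg = covered f∈F g∈F xf xg f≢g

covered⇒2≤N : ∀ {F x} → DoublyCovered F x → 2 ℕ.≤ N x F
covered⇒2≤N {F} {x} (covered f∈ g∈ xf xg f≢g) =
  2≤length (member f∈ xf) (member g∈ xg) f≢g
  where
  member : ∀ {f} → f ∈ F → x ∈ᵢ f → f ∈ deduplicate _≟ᵢ_ (filter (x ∈ᵢ?_) F)
  member f∈ xf = ∈-deduplicate⁺ _≟ᵢ_ (∈-filter⁺ (x ∈ᵢ?_) f∈ xf)

bad⁺ : ∀ {F s} → IsInterval s → (∀ x → x ∈ᵢ s → DoublyCovered (F ∣ s) x) → Bad F s
bad⁺ s-nonempty cover = s-nonempty , λ x x∈s → covered⇒2≤N (cover x x∈s)

bad⁻ : ∀ {F s} → Bad F s → ∀ {x} → x ∈ᵢ s → DoublyCovered (F ∣ s) x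
bad⁻ (_ , cover) x∈s = 2≤N⇒covered (cover _ x∈s)

≈F-refl : ∀ {F} → F ≈F F
≈F-refl _ = ⇔-refl

≈F-sym : ∀ {F G} → F ≈F G → G ≈F F
≈F-sym F≈G i = ⇔-sym (F≈G i)

≈F-trans : ∀ {F G H} → F ≈F G → G ≈F H → F ≈F H
≈F-trans F≈G G≈H i = ⇔-trans (F≈G i) (G≈H i)

∣-resp : ∀ {F G s f} → F ≈F G → f ∈ F ∣ s → f ∈ G ∣ s
∣-resp {F} {G} F≈G f∈ with ∈-∣⁻ {F} f∈
... | f∈F , f⊆s = ∈-∣⁺ {G} (Equivalence.to (F≈G _) f∈F) f⊆s

bad-resp : ∀ {F G s} → F ≈F G → Bad F s → Bad G s
bad-resp {F} {G} F≈G b =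
  bad⁺ {G} (proj₁ b) λ _ x∈s → covered-mono (λ f∈ _ → ∣-resp F≈G f∈) (bad⁻ {F} b x∈s)

minimalBad-resp : ∀ {F G s} → F ≈F G → MinimalBad F s → MinimalBad G s
minimalBad-resp F≈G (b , minimal) =
  bad-resp F≈G b , λ t t-bad → minimal t (bad-resp (≈F-sym F≈G) t-bad)

noBad-resp : ∀ {F G} → F ≈F G → ¬ HasBad F → ¬ HasBad G
noBad-resp F≈G no-bad (s , b) = no-bad (s , bad-resp (≈F-sym F≈G) b)

maximal-resp : ∀ {F G s m} → F ≈F G → Maximal F s m → Maximal G s m
maximal-resp F≈G (m∈ , maximal) =
  ∣-resp F≈G m∈ , λ f f∈ m⊆f → maximal f (∣-resp (≈F-sym F≈G) f∈) m⊆f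

consecutive-resp : ∀ {F G s m₁ m₂} → F ≈F G → Consecutive F s m₁ m₂ → Consecutive G s m₁ m₂
consecutive-resp F≈G (max₁ , max₂ , l₁<l₂ , nothing-between) =
  maximal-resp F≈G max₁ , maximal-resp F≈G max₂ , l₁<l₂ ,
  λ m max → nothing-between m (maximal-resp (≈F-sym F≈G) max)

inReduce-resp : ∀ {F G s i} → F ≈F G → InReduce F s i → InReduce G s i
inReduce-resp F≈G (inj₁ (i∈ , ¬max)) =
  inj₁ (Equivalence.to (F≈G _) i∈ , ¬max ∘ maximal-resp (≈F-sym F≈G))
inReduce-resp F≈G (inj₂ (m₁ , m₂ , c , eq)) = inj₂ (m₁ , m₂ , consecutive-resp F≈G c , eq)

isReduce-resp : ∀ {F G s R} → F ≈F G → IsReduce F s R → IsReduce G s R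
isReduce-resp F≈G red i =
  mk⇔ (inReduce-resp F≈G ∘ Equivalence.to (red i)) (Equivalence.from (red i) ∘ inReduce-resp (≈F-sym F≈G))

isReduce-unique : ∀ {G s R R'} → IsReduce G s R → IsReduce G s R' → R ≈F R'
isReduce-unique red red' i = ⇔-trans (red i) (⇔-sym (red' i))

run-resp : ∀ {F G ss H} → F ≈F G → Run F ss H → ∃[ H' ] Run G ss H' × H ≈F H'
run-resp F≈G (stop no-bad) = _ , stop (noBad-resp F≈G no-bad) , F≈G
run-resp F≈G (step s-min red run) =
  _ , step (minimalBad-resp F≈G s-min) (isReduce-resp F≈G red) run , ≈F-refl

module _ {P : Interval → Set} (P? : ∀ i → Dec (P i)) (key : Interval → ℤ) {L : Family} where

  private
    candidates : Family
    candidates = filter P? L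

  minimal-key : ∀ {w} → w ∈ L → P w →
                ∃[ y ] (y ∈ L × P y) × (∀ {z} → z ∈ L → P z → key y ≤ key z)
  minimal-key {w} w∈ pw =
    argmin key w candidates ,
    argmin-all key (w∈ , pw) (All.tabulate (∈-filter⁻ P?)) ,
    λ z∈ pz → All.lookup (f[argmin]≤f[xs] w candidates) (∈-filter⁺ P? z∈ pz)

  maximal-key : ∀ {w} → w ∈ L → P w →
                ∃[ y ] (y ∈ L × P y) × (∀ {z} → z ∈ L → P z → key z ≤ key y)
  maximal-key {w} w∈ pw =
    argmax key w candidates ,
    argmax-all key (w∈ , pw) (All.tabulate (∈-filter⁻ P?)) ,
    λ z∈ pz → All.lookup (f[xs]≤f[argmax] w candidates) (∈-filter⁺ P? z∈ pz)

growˡ growʳ grow : Interval → Interval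
growˡ (a , b) = (ℤ.pred a , b)
growʳ (a , b) = (a , ℤ.suc b)
grow (a , b) = (ℤ.pred a , ℤ.suc b)

⊆growˡ : ∀ i → i ⊆ᵢ growˡ i
⊆growˡ _ = ℤP.i≤j⇒pred[i]≤j ℤP.≤-refl , ℤP.≤-refl

⊆growʳ : ∀ i → i ⊆ᵢ growʳ i
⊆growʳ _ = ℤP.≤-refl , ℤP.i≤suc[i] _

growˡ⊆grow : ∀ i → growˡ i ⊆ᵢ grow i
growˡ⊆grow _ = ℤP.≤-refl , ℤP.i≤suc[i] _

growʳ⊆grow : ∀ i → growʳ i ⊆ᵢ grow i
growʳ⊆grow _ = ℤP.i≤j⇒pred[i]≤j ℤP.≤-refl , ℤP.≤-refl

Below : Family → Interval → Interval → Set
Below H w j = ∃[ f ] f ∈ H ∣ w × j ⊆ᵢ f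

below? : ∀ H w j → Dec (Below H w j)
below? H w j = map′ find (λ (_ , f∈ , j⊆f) → lose f∈ j⊆f) (any? (j ⊆ᵢ?_) (H ∣ w))

below-mono : ∀ {H w j j'} → j' ⊆ᵢ j → Below H w j → Below H w j'
below-mono j'⊆j (f , f∈ , j⊆f) = f , f∈ , ⊆ᵢ-trans j'⊆j j⊆f

count : ∀ {A : Set} → Dec A → ℕ
count (yes _) = 1
count (no _) = 0

count-yes : ∀ {A : Set} (a : Dec A) → A → count a ≡ 1
count-yes (yes _) _ = refl
count-yes (no ¬a) a = ⊥-elim (¬a a)

count-no : ∀ {A : Set} (a : Dec A) → ¬ A → count a ≡ 0
count-no (yes a) ¬a = ⊥-elim (¬a a)
count-no (no _) _ = refl

count-≡ : ∀ {A B : Set} (a : Dec A) (b : Dec B) →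
          (A → ¬ B → ⊥) → (B → ¬ A → ⊥) → count a ≡ count b
count-≡ (yes _) (yes _) _ _ = refl
count-≡ (no _) (no _) _ _ = refl
count-≡ (yes a) (no ¬b) only-a _ = ⊥-elim (only-a a ¬b)
count-≡ (no ¬a) (yes b) _ only-b = ⊥-elim (only-b b ¬a)

count-≡⇒⇔ : ∀ {A B : Set} (a : Dec A) (b : Dec B) → count a ≡ count b → A ⇔ B
count-≡⇒⇔ (yes a) (yes b) _ = mk⇔ (λ _ → b) (λ _ → a)
count-≡⇒⇔ (no ¬a) (no ¬b) _ = mk⇔ (⊥-elim ∘ ¬a) (⊥-elim ∘ ¬b)

-- [i ∈ H] − [i ∈ G] = d (growˡ i) + d (growʳ i) − d i − d (grow i), rearranged to avoid subtraction in ℕ.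
record Differs (G H : Family) (d : Interval → ℕ) : Set where
  constructor differs
  field
    at : ∀ i → count (i ∈? H) + (d i + d (grow i)) ≡ count (i ∈? G) + (d (growˡ i) + d (growʳ i))

differs-trans : ∀ {G H K d e} → Differs G H d → Differs H K e → Differs G K (λ j → d j + e j)
differs-trans {G} {H} {K} {d} {e} (differs G→H) (differs H→K) .Differs.at i = ℕP.+-cancelʳ-≡ h _ _ (begin
  k + ((d i + e i) + (d (grow i) + e (grow i))) + h
    ≡⟨ shuffle k h (d i) (e i) (d (grow i)) (e (grow i)) ⟩
  (k + (e i + e (grow i))) + (h + (d i + d (grow i)))
    ≡⟨ cong₂ _+_ (H→K i) (G→H i) ⟩
  (h + (e (growˡ i) + e (growʳ i))) + (g + (d (growˡ i) + d (growʳ i)))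
    ≡⟨ unshuffle g h (d (growˡ i)) (e (growˡ i)) (d (growʳ i)) (e (growʳ i)) ⟩
  g + ((d (growˡ i) + e (growˡ i)) + (d (growʳ i) + e (growʳ i))) + h ∎)
  where
  open ≡-Reasoning
  g = count (i ∈? G)
  h = count (i ∈? H)
  k = count (i ∈? K)
  shuffle : ∀ k h a b c d → k + ((a + b) + (c + d)) + h ≡ (k + (b + d)) + (h + (a + c))
  shuffle = solve-∀
  unshuffle : ∀ g h a b c d → (h + (b + d)) + (g + (a + c)) ≡ g + ((a + b) + (c + d)) + h
  unshuffle = solve-∀

differs-unique : ∀ {G H K d} → Differs G H d → Differs G K d → H ≈F K
differs-unique {H = H} {K} (differs G→H) (differs G→K) i =
  count-≡⇒⇔ (i ∈? H) (i ∈? K) (ℕP.+-cancelʳ-≡ _ _ _ (trans (G→H i) (sym (G→K i))))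

differs-resp : ∀ {G H d e} → (∀ j → d j ≡ e j) → Differs G H d → Differs G H e
differs-resp {G} {H} {d} {e} d≗e (differs G→H) = differs λ i →
  subst₂ (λ x y → count (i ∈? H) + x ≡ count (i ∈? G) + y)
         (cong₂ _+_ (d≗e i) (d≗e (grow i))) (cong₂ _+_ (d≗e (growˡ i)) (d≗e (growʳ i))) (G→H i)

count-exchange : ∀ {A A' B B' : Set} (a : Dec A) (a' : Dec A') (b : Dec B) (b' : Dec B') →
                 (A' → A) → (B' → B) → (A → ¬ A' → B × ¬ B') → (B → ¬ B' → A × ¬ A') →
                 count a + count b' ≡ count b + count a'
count-exchange a (yes a') b (yes b') a'⇒a b'⇒b _ _
  rewrite count-yes a (a'⇒a a') | count-yes b (b'⇒b b') = refl
count-exchange a (yes a') b (no ¬b') a'⇒a _ _ lostᵇ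
  rewrite count-yes a (a'⇒a a') | count-no b (λ B → proj₂ (lostᵇ B ¬b') a') = refl
count-exchange a (no ¬a') b (yes b') _ b'⇒b lostᵃ _
  rewrite count-yes b (b'⇒b b') | count-no a (λ A → proj₂ (lostᵃ A ¬a') b') = refl
count-exchange a (no ¬a') b (no ¬b') _ _ lostᵃ lostᵇ =
  cong (_+ 0) (count-≡ a b (λ A ¬B → ¬B (proj₁ (lostᵃ A ¬a'))) (λ B ¬A → ¬A (proj₁ (lostᵇ B ¬b'))))

-- With monotone D ⊇ Dˡ, Dʳ ⊇ D², the second difference of the indicator of D is +1 exactly on
-- D ∖ (Dˡ ∪ Dʳ) and −1 exactly on (Dˡ ∩ Dʳ) ∖ D².
second-difference : ∀ {A B D Dˡ Dʳ D² : Set}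
  (a : Dec A) (b : Dec B) (d : Dec D) (dˡ : Dec Dˡ) (dʳ : Dec Dʳ) (d² : Dec D²) →
  (Dˡ → D) → (Dʳ → D) → (D² → Dˡ) → (D² → Dʳ) →
  (A → ¬ B → Dˡ × Dʳ × ¬ D²) → (Dˡ → Dʳ → ¬ D² → A × ¬ B) →
  (B → ¬ A → D × ¬ Dˡ × ¬ Dʳ) → (D → ¬ Dˡ → ¬ Dʳ → B × ¬ A) →
  count a + (count d + count d²) ≡ count b + (count dˡ + count dʳ)
second-difference a b d (yes l) (yes r) (yes l∧r) l⇒ r⇒ _ _ added _ removed _
  rewrite count-≡ a b (λ A ¬B → proj₂ (proj₂ (added A ¬B)) l∧r) (λ B ¬A → proj₁ (proj₂ (removed B ¬A)) l)
        | count-yes d (l⇒ l) = refl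
second-difference a b d (yes l) (yes r) (no ¬l∧r) l⇒ _ _ _ _ added _ _
  rewrite count-yes a (proj₁ (added l r ¬l∧r)) | count-no b (proj₂ (added l r ¬l∧r)) | count-yes d (l⇒ l) = refl
second-difference a b d (yes l) (no ¬r) d² l⇒ _ _ ²⇒r added _ removed _
  rewrite count-≡ a b (λ A ¬B → ¬r (proj₁ (proj₂ (added A ¬B)))) (λ B ¬A → proj₁ (proj₂ (removed B ¬A)) l)
        | count-yes d (l⇒ l) | count-no d² (¬r ∘ ²⇒r) = refl
second-difference a b d (no ¬l) (yes r) d² _ r⇒ ²⇒l _ added _ removed _
  rewrite count-≡ a b (λ A ¬B → ¬l (proj₁ (added A ¬B))) (λ B ¬A → proj₂ (proj₂ (removed B ¬A)) r)
        | count-yes d (r⇒ r) | count-no d² (¬l ∘ ²⇒l) = refl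
second-difference a b (yes D) (no ¬l) (no ¬r) d² _ _ ²⇒l _ _ _ _ removed
  rewrite count-yes b (proj₁ (removed D ¬l ¬r)) | count-no a (proj₂ (removed D ¬l ¬r))
        | count-no d² (¬l ∘ ²⇒l) = refl
second-difference a b (no ¬D) (no ¬l) (no ¬r) d² _ _ ²⇒l _ added _ removed _
  rewrite count-≡ a b (λ A ¬B → ¬l (proj₁ (added A ¬B))) (λ B ¬A → ¬D (proj₁ (removed B ¬A)))
        | count-no d² (¬l ∘ ²⇒l) = refl

overlapᵢ : Interval → Interval → Interval
overlapᵢ m₁ m₂ = (left m₂ , right m₁)

module Maximals (G : Family) (s : Interval) where

  Max : Interval → Set
  Max = Maximal G s

  Cons : Interval → Interval → Set
  Cons = Consecutive G s

  maximal? : ∀ m → Dec (Max m)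
  maximal? m = (m ∈? G ∣ s) ×-dec
    map′ (λ all f f∈ → All.lookup all f∈) (λ max → All.tabulate (max _))
         (all? (λ f → (m ⊆ᵢ? f) →-dec (f ≟ᵢ m)) (G ∣ s))

  consecutive? : ∀ m₁ m₂ → Dec (Cons m₁ m₂)
  consecutive? m₁ m₂ = maximal? m₁ ×-dec maximal? m₂ ×-dec (left m₁ <? left m₂) ×-dec
    map′ (λ all m max → All.lookup all (proj₁ max) max) (λ between → All.tabulate λ {m} _ → between m)
         (all? (λ m → maximal? m →-dec ¬? ((left m₁ <? left m) ×-dec (left m <? left m₂))) (G ∣ s))

  maximal⇒∈ : ∀ {m} → Max m → m ∈ G
  maximal⇒∈ max = proj₁ (∈-∣⁻ {G} (proj₁ max))

  maximal⇒⊆ : ∀ {m} → Max m → m ⊆ᵢ s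
  maximal⇒⊆ max = proj₂ (∈-∣⁻ {G} (proj₁ max))

  maximal-above : ∀ {f} → f ∈ G → f ⊆ᵢ s → ∃[ m ] Max m × f ⊆ᵢ m
  maximal-above {f} f∈ f⊆s
    with maximal-key (f ⊆ᵢ?_) right (∈-∣⁺ {G} f∈ f⊆s) ⊆ᵢ-refl
  ... | m₁ , (m₁∈ , f⊆m₁) , rightmost
    with minimal-key (λ g → (f ⊆ᵢ? g) ×-dec (right g ℤ.≟ right m₁)) left m₁∈ (f⊆m₁ , refl)
  ...   | m , (m∈ , f⊆m , rm≡rm₁) , leftmost = m , (m∈ , maximality) , f⊆m
    where
    maximality : ∀ g → g ∈ G ∣ s → m ⊆ᵢ g → g ≡ m
    maximality g g∈ m⊆g@(lg≤lm , rm≤rg) =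
      interval-≡ (ℤP.≤-antisym lg≤lm (leftmost g∈ (f⊆g , rg≡rm₁))) (trans rg≡rm₁ (sym rm≡rm₁))
      where
      f⊆g = ⊆ᵢ-trans f⊆m m⊆g
      rg≡rm₁ = ℤP.≤-antisym (rightmost g∈ f⊆g) (subst (_≤ right g) rm≡rm₁ rm≤rg)

  maximal-≡ˡ : ∀ {m m'} → Max m → Max m' → left m ≡ left m' → m ≡ m'
  maximal-≡ˡ {m} {m'} max max' eq with ℤP.≤-total (right m) (right m')
  ... | inj₁ r≤r' = sym (proj₂ max m' (proj₁ max') (ℤP.≤-reflexive (sym eq) , r≤r'))
  ... | inj₂ r'≤r = proj₂ max' m (proj₁ max) (ℤP.≤-reflexive eq , r'≤r)

  maximal-≡ʳ : ∀ {m m'} → Max m → Max m' → right m ≡ right m' → m ≡ m'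
  maximal-≡ʳ {m} {m'} max max' eq with ℤP.≤-total (left m) (left m')
  ... | inj₁ l≤l' = proj₂ max' m (proj₁ max) (l≤l' , ℤP.≤-reflexive (sym eq))
  ... | inj₂ l'≤l = sym (proj₂ max m' (proj₁ max') (l'≤l , ℤP.≤-reflexive eq))

  maximal-<ˡ⇒<ʳ : ∀ {m m'} → Max m → Max m' → left m < left m' → right m < right m'
  maximal-<ˡ⇒<ʳ {m} {m'} max max' l<l' with right m <? right m'
  ... | yes r<r' = r<r'
  ... | no r≮r' = ⊥-elim (ℤP.<-irrefl (cong left m≡m') l<l')
    where
    m≡m' : m ≡ m'
    m≡m' = proj₂ max' m (proj₁ max) (ℤP.<⇒≤ l<l' , ℤP.≮⇒≥ r≮r')

  maximal-≤ˡ⇒≤ʳ : ∀ {m m'} → Max m → Max m' → left m ≤ left m' → right m ≤ right m'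
  maximal-≤ˡ⇒≤ʳ {m} {m'} max max' l≤l' with ℤP.<-cmp (left m) (left m')
  ... | tri< l<l' _ _ = ℤP.<⇒≤ (maximal-<ˡ⇒<ʳ max max' l<l')
  ... | tri≈ _ l≡l' _ = ℤP.≤-reflexive (cong right (maximal-≡ˡ max max' l≡l'))
  ... | tri> _ _ l'<l = ⊥-elim (ℤP.≤⇒≯ l≤l' l'<l)

  module Consec {m₁ m₂} (c : Cons m₁ m₂) where

    max₁ : Max m₁
    max₁ = proj₁ c

    max₂ : Max m₂
    max₂ = proj₁ (proj₂ c)

    <ˡ : left m₁ < left m₂
    <ˡ = proj₁ (proj₂ (proj₂ c))

    <ʳ : right m₁ < right m₂
    <ʳ = maximal-<ˡ⇒<ʳ max₁ max₂ <ˡ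

    nothing-between : ∀ m → Max m → ¬ (left m₁ < left m × left m < left m₂)
    nothing-between = proj₂ (proj₂ (proj₂ c))

    distinct : m₁ ≢ m₂
    distinct eq = ℤP.<-irrefl (cong left eq) <ˡ

    overlap-⊆₁ : overlapᵢ m₁ m₂ ⊆ᵢ m₁
    overlap-⊆₁ = ℤP.<⇒≤ <ˡ , ℤP.≤-refl

    overlap-⊆₂ : overlapᵢ m₁ m₂ ⊆ᵢ m₂
    overlap-⊆₂ = ℤP.≤-refl , ℤP.<⇒≤ <ʳ

    maximal-⊇overlap : ∀ {m} → Max m → overlapᵢ m₁ m₂ ⊆ᵢ m → m ≡ m₁ ⊎ m ≡ m₂
    maximal-⊇overlap {m} max (lm≤l₂ , r₁≤rm) with ℤP.<-cmp (left m) (left m₁)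
    ... | tri< lm<l₁ _ _ = ⊥-elim (ℤP.≤⇒≯ r₁≤rm (maximal-<ˡ⇒<ʳ max max₁ lm<l₁))
    ... | tri≈ _ lm≡l₁ _ = inj₁ (maximal-≡ˡ max max₁ lm≡l₁)
    ... | tri> _ _ l₁<lm with ℤP.<-cmp (left m) (left m₂)
    ...   | tri< lm<l₂ _ _ = ⊥-elim (nothing-between m max (l₁<lm , lm<l₂))
    ...   | tri≈ _ lm≡l₂ _ = inj₂ (maximal-≡ˡ max max₂ lm≡l₂)
    ...   | tri> _ _ l₂<lm = ⊥-elim (ℤP.≤⇒≯ lm≤l₂ l₂<lm)

  open Consec public

  successor-exists : ∀ {f m} → Max f → Max m → left f < left m →
                     ∃[ m₂ ] Cons f m₂ × left m₂ ≤ left m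
  successor-exists {f} {m} max-f max-m lf<lm
    with minimal-key (λ g → maximal? g ×-dec (left f <? left g)) left (maximal⇒∈ max-m) (max-m , lf<lm)
  ... | m₂ , (_ , max₂ , lf<l₂) , leftmost =
    m₂ , (max-f , max₂ , lf<l₂ , between) , leftmost (maximal⇒∈ max-m) (max-m , lf<lm)
    where
    between : ∀ g → Max g → ¬ (left f < left g × left g < left m₂)
    between g max-g (lf<lg , lg<l₂) = ℤP.≤⇒≯ (leftmost (maximal⇒∈ max-g) (max-g , lf<lg)) lg<l₂

  predecessor-exists : ∀ {f m} → Max f → Max m → left m < left f →
                       ∃[ m₁ ] Cons m₁ f × left m ≤ left m₁
  predecessor-exists {f} {m} max-f max-m lm<lf
    with maximal-key (λ g → maximal? g ×-dec (left g <? left f)) left (maximal⇒∈ max-m) (max-m , lm<lf)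
  ... | m₁ , (_ , max₁ , l₁<lf) , rightmost =
    m₁ , (max₁ , max-f , l₁<lf , between) , rightmost (maximal⇒∈ max-m) (max-m , lm<lf)
    where
    between : ∀ g → Max g → ¬ (left m₁ < left g × left g < left f)
    between g max-g (l₁<lg , lg<lf) = ℤP.≤⇒≯ (rightmost (maximal⇒∈ max-g) (max-g , lg<lf)) l₁<lg

  successor-unique : ∀ {m₁ m₂ m₂'} → Cons m₁ m₂ → Cons m₁ m₂' → m₂ ≡ m₂'
  successor-unique {m₂ = m₂} {m₂'} c c' with ℤP.<-cmp (left m₂) (left m₂')
  ... | tri< l<l' _ _ = ⊥-elim (nothing-between c' m₂ (max₂ c) (<ˡ c , l<l'))
  ... | tri≈ _ l≡l' _ = maximal-≡ˡ (max₂ c) (max₂ c') l≡l'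
  ... | tri> _ _ l'<l = ⊥-elim (nothing-between c m₂' (max₂ c') (<ˡ c' , l'<l))

  predecessor-unique : ∀ {m₁ m₁' m₂} → Cons m₁ m₂ → Cons m₁' m₂ → m₁ ≡ m₁'
  predecessor-unique {m₁} {m₁'} c c' with ℤP.<-cmp (left m₁) (left m₁')
  ... | tri< l<l' _ _ = ⊥-elim (nothing-between c m₁' (max₁ c') (l<l' , <ˡ c'))
  ... | tri≈ _ l≡l' _ = maximal-≡ˡ (max₁ c) (max₁ c') l≡l'
  ... | tri> _ _ l'<l = ⊥-elim (nothing-between c' m₁ (max₁ c) (l'<l , <ˡ c))

  overlap-injective : ∀ {m₁ m₂ m₁' m₂'} → Cons m₁ m₂ → Cons m₁' m₂' →
                      overlapᵢ m₁ m₂ ≡ overlapᵢ m₁' m₂' → m₁ ≡ m₁' × m₂ ≡ m₂'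
  overlap-injective c c' eq =
    maximal-≡ʳ (max₁ c) (max₁ c') (cong right eq) , maximal-≡ˡ (max₂ c) (max₂ c') (cong left eq)

  -- A consecutive pair with one end h, on the side of h facing m.
  record Adjacent (h m : Interval) : Set where
    constructor adjacent
    field
      {m₁ m₂}     : Interval
      consecutive : Cons m₁ m₂
      position    : (h ≡ m₁ × left m₂ ≤ left m) ⊎ (h ≡ m₂ × right m ≤ right m₁)

  junction : ∀ {h m} → Adjacent h m → Interval
  junction (adjacent {m₁} {m₂} _ _) = overlapᵢ m₁ m₂

  junction-⊆ : ∀ {h m} (A : Adjacent h m) → junction A ⊆ᵢ h
  junction-⊆ (adjacent c (inj₁ (refl , _))) = overlap-⊆₁ c
  junction-⊆ (adjacent c (inj₂ (refl , _))) = overlap-⊆₂ c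

  ⊆-junction : ∀ {h m j} (A : Adjacent h m) → j ⊆ᵢ h → j ⊆ᵢ m → j ⊆ᵢ junction A
  ⊆-junction (adjacent _ (inj₁ (refl , l₂≤lm))) (_ , rj≤rh) (lm≤lj , _) = ℤP.≤-trans l₂≤lm lm≤lj , rj≤rh
  ⊆-junction (adjacent _ (inj₂ (refl , rm≤r₁))) (lh≤lj , _) (_ , rj≤rm) = lh≤lj , ℤP.≤-trans rj≤rm rm≤r₁

  ∈-junction : ∀ {h m x} (A : Adjacent h m) → x ∈ᵢ h → x ∈ᵢ m → x ∈ᵢ junction A
  ∈-junction (adjacent _ (inj₁ (refl , l₂≤lm))) (_ , x<rh) (lm≤x , _) = ℤP.≤-trans l₂≤lm lm≤x , x<rh
  ∈-junction (adjacent _ (inj₂ (refl , rm≤r₁))) (lh≤x , _) (_ , x<rm) = lh≤x , ℤP.<-≤-trans x<rm rm≤r₁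

  adjacent-exists : ∀ {h m} → Max h → Max m → h ≢ m → Adjacent h m
  adjacent-exists {h} {m} max-h max-m h≢m with ℤP.<-cmp (left h) (left m)
  ... | tri< lh<lm _ _ =
    let _ , c , l₂≤lm = successor-exists max-h max-m lh<lm in adjacent c (inj₁ (refl , l₂≤lm))
  ... | tri≈ _ lh≡lm _ = ⊥-elim (h≢m (maximal-≡ˡ max-h max-m lh≡lm))
  ... | tri> _ _ lm<lh =
    let _ , c , lm≤l₁ = predecessor-exists max-h max-m lm<lh
    in adjacent c (inj₂ (refl , maximal-≤ˡ⇒≤ʳ max-m (max₁ c) lm≤l₁))

  junction-injective : ∀ {h₁ h₂ m} → Max m → m ≢ h₁ → m ≢ h₂ → h₁ ≢ h₂ →
                       (A₁ : Adjacent h₁ m) (A₂ : Adjacent h₂ m) → junction A₁ ≢ junction A₂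
  junction-injective {m = m} max m≢h₁ m≢h₂ h₁≢h₂ (adjacent {m₁} {m₂} c p₁) (adjacent c' p₂) eq
    with overlap-injective c c' eq
  ... | refl , refl = opposite p₁ p₂ m≢h₁ m≢h₂ h₁≢h₂
    where
    -- the same pair seen from both of its ends would put m inside m₁
    m₁≡m : left m₂ ≤ left m → right m ≤ right m₁ → m₁ ≡ m
    m₁≡m l₂≤lm rm≤r₁ = proj₂ max m₁ (proj₁ (max₁ c)) (ℤP.≤-trans (ℤP.<⇒≤ (<ˡ c)) l₂≤lm , rm≤r₁)
    opposite : ∀ {h₁ h₂} → (h₁ ≡ m₁ × left m₂ ≤ left m) ⊎ (h₁ ≡ m₂ × right m ≤ right m₁) →
               (h₂ ≡ m₁ × left m₂ ≤ left m) ⊎ (h₂ ≡ m₂ × right m ≤ right m₁) →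
               m ≢ h₁ → m ≢ h₂ → h₁ ≢ h₂ → ⊥
    opposite (inj₁ (refl , _)) (inj₁ (refl , _)) _ _ h₁≢h₂ = h₁≢h₂ refl
    opposite (inj₂ (refl , _)) (inj₂ (refl , _)) _ _ h₁≢h₂ = h₁≢h₂ refl
    opposite (inj₁ (refl , l₂≤lm)) (inj₂ (refl , rm≤r₁)) m≢m₁ _ _ = m≢m₁ (sym (m₁≡m l₂≤lm rm≤r₁))
    opposite (inj₂ (refl , rm≤r₁)) (inj₁ (refl , l₂≤lm)) _ m≢m₁ _ = m≢m₁ (sym (m₁≡m l₂≤lm rm≤r₁))

  data Side : Set where
    ◁ ▷ : Side

  parent : Side → ∀ {m₁ m₂} → Cons m₁ m₂ → Interval
  parent ◁ {m₁} _ = m₁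
  parent ▷ {m₂ = m₂} _ = m₂

  parent-maximal : ∀ σ {m₁ m₂} (c : Cons m₁ m₂) → Max (parent σ c)
  parent-maximal ◁ c = max₁ c
  parent-maximal ▷ c = max₂ c

  overlap-⊆parent : ∀ σ {m₁ m₂} (c : Cons m₁ m₂) → overlapᵢ m₁ m₂ ⊆ᵢ parent σ c
  overlap-⊆parent ◁ c = overlap-⊆₁ c
  overlap-⊆parent ▷ c = overlap-⊆₂ c

  parent-injective : ∀ σ {m₁ m₂ m₁' m₂'} (c : Cons m₁ m₂) (c' : Cons m₁' m₂') →
                     parent σ c ≡ parent σ c' → overlapᵢ m₁ m₂ ≡ overlapᵢ m₁' m₂'
  parent-injective ◁ c c' refl with successor-unique c c'
  ... | refl = refl
  parent-injective ▷ c c' refl with predecessor-unique c c'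
  ... | refl = refl

  below-maximal : ∀ {j} → Below G s j → ∃[ m ] Max m × j ⊆ᵢ m
  below-maximal (f , f∈ , j⊆f) with ∈-∣⁻ {G} f∈
  ... | f∈G , f⊆s with maximal-above f∈G f⊆s
  ...   | m , max , f⊆m = m , max , ⊆ᵢ-trans j⊆f f⊆m

  maximal-below : ∀ {j m} → Max m → j ⊆ᵢ m → Below G s j
  maximal-below {m = m} max j⊆m = m , proj₁ max , j⊆m

  maximal-profile : ∀ {i} → Max i → Below G s i × ¬ Below G s (growˡ i) × ¬ Below G s (growʳ i)
  maximal-profile {i} max = maximal-below max ⊆ᵢ-refl , no-growˡ , no-growʳ
    where
    no-growˡ : ¬ Below G s (growˡ i)
    no-growˡ (f , f∈ , gi⊆f) with proj₂ max f f∈ (⊆ᵢ-trans (⊆growˡ i) gi⊆f)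
    ... | refl = ℤP.<-irrefl refl (ℤP.≤-<-trans (proj₁ gi⊆f) (ℤP.i≤pred[j]⇒i<j ℤP.≤-refl))
    no-growʳ : ¬ Below G s (growʳ i)
    no-growʳ (f , f∈ , gi⊆f) with proj₂ max f f∈ (⊆ᵢ-trans (⊆growʳ i) gi⊆f)
    ... | refl = ℤP.<-irrefl refl (ℤP.<-≤-trans (ℤP.suc[i]≤j⇒i<j ℤP.≤-refl) (proj₂ gi⊆f))

  profile-maximal : ∀ {i} → Below G s i → ¬ Below G s (growˡ i) → ¬ Below G s (growʳ i) → Max i
  profile-maximal {i} below no-growˡ no-growʳ with below-maximal below
  ... | m , max , i⊆m@(lm≤li , ri≤rm) with left m <? left i | right i <? right m
  ...   | yes lm<li | _ = ⊥-elim (no-growˡ (maximal-below max (ℤP.i<j⇒i≤pred[j] lm<li , ri≤rm)))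
  ...   | no _ | yes ri<rm = ⊥-elim (no-growʳ (maximal-below max (lm≤li , ℤP.i<j⇒suc[i]≤j ri<rm)))
  ...   | no lm≮li | no ri≮rm
    rewrite ⊆ᵢ-antisym i⊆m (ℤP.≮⇒≥ lm≮li , ℤP.≮⇒≥ ri≮rm) = max

  junction-profile : ∀ {m₁ m₂} → Cons m₁ m₂ →
                     Below G s (growˡ (overlapᵢ m₁ m₂)) × Below G s (growʳ (overlapᵢ m₁ m₂)) ×
                     ¬ Below G s (grow (overlapᵢ m₁ m₂))
  junction-profile {m₁} {m₂} c =
    maximal-below (max₁ c) (ℤP.i<j⇒i≤pred[j] (<ˡ c) , ℤP.≤-refl) ,
    maximal-below (max₂ c) (ℤP.≤-refl , ℤP.i<j⇒suc[i]≤j (<ʳ c)) ,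
    no-grow
    where
    no-grow : ¬ Below G s (grow (overlapᵢ m₁ m₂))
    no-grow below with below-maximal below
    ... | m , max , (lm≤l₂-1 , r₁+1≤rm)
      with maximal-⊇overlap c max (ℤP.<⇒≤ (ℤP.i≤pred[j]⇒i<j lm≤l₂-1) , ℤP.<⇒≤ (ℤP.suc[i]≤j⇒i<j r₁+1≤rm))
    ... | inj₁ refl = ℤP.<-irrefl refl (ℤP.suc[i]≤j⇒i<j r₁+1≤rm)
    ... | inj₂ refl = ℤP.<-irrefl refl (ℤP.i≤pred[j]⇒i<j lm≤l₂-1)

  profile-junction : ∀ {i} → Below G s (growˡ i) → Below G s (growʳ i) → ¬ Below G s (grow i) →
                     ∃[ m₁ ] ∃[ m₂ ] Cons m₁ m₂ × i ≡ overlapᵢ m₁ m₂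
  profile-junction {i} belowˡ belowʳ no-grow
    with below-maximal belowˡ | below-maximal belowʳ
  ... | m , max , (lm≤li-1 , ri≤rm) | m' , max' , (lm'≤li , ri+1≤rm') =
    m , m' , (max , max' , lm<lm' , nothing-inside) , interval-≡ (sym lm'≡li) (sym rm≡ri)
    where
    rm≡ri : right m ≡ right i
    rm≡ri with right i <? right m
    ... | yes ri<rm = ⊥-elim (no-grow (maximal-below max (lm≤li-1 , ℤP.i<j⇒suc[i]≤j ri<rm)))
    ... | no ri≮rm = ℤP.≤-antisym (ℤP.≮⇒≥ ri≮rm) ri≤rm
    lm'≡li : left m' ≡ left i
    lm'≡li with left m' <? left i
    ... | yes lm'<li = ⊥-elim (no-grow (maximal-below max' (ℤP.i<j⇒i≤pred[j] lm'<li , ri+1≤rm')))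
    ... | no lm'≮li = ℤP.≤-antisym lm'≤li (ℤP.≮⇒≥ lm'≮li)
    lm<lm' : left m < left m'
    lm<lm' = subst (left m <_) (sym lm'≡li) (ℤP.i≤pred[j]⇒i<j lm≤li-1)
    nothing-inside : ∀ m'' → Max m'' → ¬ (left m < left m'' × left m'' < left m')
    nothing-inside m'' max'' (lm<lm'' , lm''<lm') =
      no-grow (maximal-below max'' (ℤP.i<j⇒i≤pred[j] (subst (left m'' <_) lm'≡li lm''<lm') ,
                                    ℤP.i<j⇒suc[i]≤j (subst (_< right m'') rm≡ri (maximal-<ˡ⇒<ʳ max max'' lm<lm''))))

reduce : Family → Interval → Family
reduce G s =
  filter (¬? ∘ maximal?) G ++ map (uncurry overlapᵢ) (filter (uncurry consecutive?) (cartesianProduct G G))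
  where open Maximals G s

reduce-isReduce : ∀ G s → IsReduce G s (reduce G s)
reduce-isReduce G s i = mk⇔ to from
  where
  open Maximals G s
  kept = filter (¬? ∘ maximal?) G
  to : i ∈ reduce G s → InReduce G s i
  to i∈ with ∈-++⁻ kept i∈
  ... | inj₁ i∈kept = inj₁ (∈-filter⁻ (¬? ∘ maximal?) {xs = G} i∈kept)
  ... | inj₂ i∈new with ∈-map⁻ (uncurry overlapᵢ) i∈new
  ...   | (m₁ , m₂) , p∈ , refl =
    inj₂ (m₁ , m₂ , proj₂ (∈-filter⁻ (uncurry consecutive?) {xs = cartesianProduct G G} p∈) , refl)
  from : InReduce G s i → i ∈ reduce G s
  from (inj₁ (i∈G , ¬max)) = ∈-++⁺ˡ (∈-filter⁺ (¬? ∘ maximal?) i∈G ¬max)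
  from (inj₂ (m₁ , m₂ , c , refl)) =
    ∈-++⁺ʳ kept (∈-map⁺ (uncurry overlapᵢ)
      (∈-filter⁺ (uncurry consecutive?) (∈-cartesianProduct⁺ (maximal⇒∈ (max₁ c)) (maximal⇒∈ (max₂ c))) c))

module MinimalBadInterval (G : Family) (wf : WellFormed G) (s : Interval) (s-min : MinimalBad G s) where

  open Maximals G s

  s-bad : Bad G s
  s-bad = proj₁ s-min

  cover-s : ∀ {x} → x ∈ᵢ s → DoublyCovered (G ∣ s) x
  cover-s = bad⁻ {G} s-bad

  proper-good : ∀ {w} → w ⊆ᵢ s → w ≢ s → ¬ Bad G w
  proper-good w⊆s w≢s w-bad = w≢s (proj₂ s-min _ w-bad w⊆s)

  -- Were the overlap of consecutive maximal members empty or already in G,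
  -- the proper prefix [left s, right m₁) of s would be bad.
  module _ {m₁ m₂} (c : Cons m₁ m₂) where

    private
      prefix : Interval
      prefix = (left s , right m₁)

      prefix-⊆ : prefix ⊆ᵢ s
      prefix-⊆ = ℤP.≤-refl , ℤP.<⇒≤ (ℤP.<-≤-trans (<ʳ c) (proj₂ (maximal⇒⊆ (max₂ c))))

      prefix-≢ : prefix ≢ s
      prefix-≢ eq = ℤP.<-irrefl (cong right eq) (ℤP.<-≤-trans (<ʳ c) (proj₂ (maximal⇒⊆ (max₂ c))))

      ⊆prefix : ∀ {f x} → f ∈ G ∣ s → x ∈ᵢ f → x < left m₂ → f ∈ G ∣ prefix
      ⊆prefix {f} f∈ (lf≤x , _) x<l₂ with ∈-∣⁻ {G} f∈
      ... | f∈G , f⊆s with maximal-above f∈G f⊆s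
      ...   | m , max , f⊆m = ∈-∣⁺ {G} f∈G (proj₁ f⊆s , ℤP.≤-trans (proj₂ f⊆m) rm≤r₁)
        where
        lm<l₂ = ℤP.≤-<-trans (ℤP.≤-trans (proj₁ f⊆m) lf≤x) x<l₂
        rm≤r₁ : right m ≤ right m₁
        rm≤r₁ with left m ≤? left m₁
        ... | yes lm≤l₁ = maximal-≤ˡ⇒≤ʳ max (max₁ c) lm≤l₁
        ... | no lm≰l₁ = ⊥-elim (nothing-between c m max (ℤP.≰⇒> lm≰l₁ , lm<l₂))

      prefix-bad : right m₁ ≤ left m₂ ⊎ overlapᵢ m₁ m₂ ∈ G → Bad G prefix
      prefix-bad empty-or-old =
        bad⁺ {G} (ℤP.≤-<-trans (proj₁ (maximal⇒⊆ (max₁ c))) (wf _ (maximal⇒∈ (max₁ c)))) cover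
        where
        right-part : ∀ {x} → left m₂ ≤ x → x < right m₁ → right m₁ ≤ left m₂ ⊎ overlapᵢ m₁ m₂ ∈ G →
                     DoublyCovered (G ∣ prefix) x
        right-part l₂≤x x<r₁ (inj₁ r₁≤l₂) =
          ⊥-elim (ℤP.<-irrefl refl (ℤP.<-≤-trans x<r₁ (ℤP.≤-trans r₁≤l₂ l₂≤x)))
        right-part l₂≤x x<r₁ (inj₂ overlap∈G) =
          covered (∈-∣⁺ {G} (maximal⇒∈ (max₁ c)) (proj₁ (maximal⇒⊆ (max₁ c)) , ℤP.≤-refl))
                  (∈-∣⁺ {G} overlap∈G (ℤP.≤-trans (proj₁ (maximal⇒⊆ (max₁ c))) (ℤP.<⇒≤ (<ˡ c)) , ℤP.≤-refl))
                  (ℤP.≤-trans (ℤP.<⇒≤ (<ˡ c)) l₂≤x , x<r₁) (l₂≤x , x<r₁)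
                  (λ eq → ℤP.<-irrefl (cong left eq) (<ˡ c))

        cover : ∀ x → x ∈ᵢ prefix → DoublyCovered (G ∣ prefix) x
        cover x (ls≤x , x<r₁) with x <? left m₂
        ... | yes x<l₂ =
          covered-mono (λ f∈ xf → ⊆prefix f∈ xf x<l₂) (cover-s (ls≤x , ℤP.<-≤-trans x<r₁ (proj₂ prefix-⊆)))
        ... | no x≮l₂ = right-part (ℤP.≮⇒≥ x≮l₂) x<r₁ empty-or-old

    overlap-nonempty : IsInterval (overlapᵢ m₁ m₂)
    overlap-nonempty with left m₂ <? right m₁
    ... | yes l₂<r₁ = l₂<r₁
    ... | no l₂≮r₁ = ⊥-elim (proper-good prefix-⊆ prefix-≢ (prefix-bad (inj₁ (ℤP.≮⇒≥ l₂≮r₁))))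

    overlap-∉ : overlapᵢ m₁ m₂ ∉ G
    overlap-∉ overlap∈G = proper-good prefix-⊆ prefix-≢ (prefix-bad (inj₂ overlap∈G))

module Reduction (G : Family) (wf : WellFormed G) (s : Interval) (s-min : MinimalBad G s)
                 (G₁ : Family) (red : IsReduce G s G₁) where

  open Maximals G s public
  open MinimalBadInterval G wf s s-min public

  data Origin (g : Interval) : Set where
    old : g ∈ G → ¬ Max g → Origin g
    new : ∀ {m₁ m₂} → Cons m₁ m₂ → g ≡ overlapᵢ m₁ m₂ → Origin g

  origin : ∀ {g} → g ∈ G₁ → Origin g
  origin g∈ with Equivalence.to (red _) g∈
  ... | inj₁ (g∈G , ¬max) = old g∈G ¬max
  ... | inj₂ (_ , _ , c , eq) = new c eq

  old∈ : ∀ {g} → g ∈ G → ¬ Max g → g ∈ G₁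
  old∈ g∈G ¬max = Equivalence.from (red _) (inj₁ (g∈G , ¬max))

  new∈ : ∀ {m₁ m₂} → Cons m₁ m₂ → overlapᵢ m₁ m₂ ∈ G₁
  new∈ c = Equivalence.from (red _) (inj₂ (_ , _ , c , refl))

  wellFormed : WellFormed G₁
  wellFormed g g∈ with origin g∈
  ... | old g∈G _ = wf g g∈G
  ... | new c refl = overlap-nonempty c

  representative : Side → ∀ {g} → Origin g → Interval
  representative σ {g} (old _ _) = g
  representative σ (new c _) = parent σ c

  ∈-representative : ∀ σ {g x} (o : Origin g) → x ∈ᵢ g → x ∈ᵢ representative σ o
  ∈-representative σ (old _ _) x∈g = x∈g
  ∈-representative σ (new c refl) x∈g = ∈ᵢ-mono x∈g (overlap-⊆parent σ c)

  representative-injective : ∀ σ {g g'} (o : Origin g) (o' : Origin g') →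
                             representative σ o ≡ representative σ o' → g ≡ g'
  representative-injective σ (old _ _) (old _ _) eq = eq
  representative-injective σ (old _ ¬max) (new c' _) refl = ⊥-elim (¬max (parent-maximal σ c'))
  representative-injective σ (new c _) (old _ ¬max) refl = ⊥-elim (¬max (parent-maximal σ c))
  representative-injective σ (new c refl) (new c' refl) eq = parent-injective σ c c' eq

  lift-cover : ∀ σ {v w y} →
               (∀ {g} → g ∈ G → ¬ Max g → g ⊆ᵢ v → g ⊆ᵢ w) →
               (∀ {m₁ m₂} (c : Cons m₁ m₂) → overlapᵢ m₁ m₂ ⊆ᵢ v → parent σ c ⊆ᵢ w) →
               DoublyCovered (G₁ ∣ v) y → DoublyCovered (G ∣ w) y
  lift-cover σ {v} {w} old⊆ new⊆ (covered f∈ g∈ yf yg f≢g) =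
    covered (lift (origin f∈₁) f⊆v) (lift (origin g∈₁) g⊆v)
            (∈-representative σ (origin f∈₁) yf) (∈-representative σ (origin g∈₁) yg)
            (f≢g ∘ representative-injective σ (origin f∈₁) (origin g∈₁))
    where
    f∈₁ = proj₁ (∈-∣⁻ {G₁} f∈)
    f⊆v = proj₂ (∈-∣⁻ {G₁} f∈)
    g∈₁ = proj₁ (∈-∣⁻ {G₁} g∈)
    g⊆v = proj₂ (∈-∣⁻ {G₁} g∈)
    lift : ∀ {f} (o : Origin f) → f ⊆ᵢ v → representative σ o ∈ G ∣ w
    lift (old f∈G ¬max) f⊆v = ∈-∣⁺ {G} f∈G (old⊆ f∈G ¬max f⊆v)
    lift (new c refl) f⊆v = ∈-∣⁺ {G} (maximal⇒∈ (parent-maximal σ c)) (new⊆ c f⊆v)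

  straddled-good₁ : ∀ {v m} → v ⊆ᵢ s → v ≢ s → Max m → left m < left v → right v < right m → ¬ Bad G₁ v
  straddled-good₁ {v} v⊆s v≢s max lm<lv rv<rm v-bad =
    proper-good v⊆s v≢s (bad⁺ {G} (proj₁ v-bad) λ _ y∈v →
      lift-cover ◁ (λ _ _ g⊆v → g⊆v) (λ c o⊆v → ⊥-elim (not-inside c o⊆v)) (bad⁻ {G₁} v-bad y∈v))
    where
    not-inside : ∀ {m₁ m₂} (c : Cons m₁ m₂) → ¬ overlapᵢ m₁ m₂ ⊆ᵢ v
    not-inside c (lv≤l₂ , r₁≤rv)
      with maximal-⊇overlap c max (ℤP.≤-trans (ℤP.<⇒≤ lm<lv) lv≤l₂ , ℤP.≤-trans r₁≤rv (ℤP.<⇒≤ rv<rm))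
    ... | inj₁ refl = ℤP.≤⇒≯ r₁≤rv rv<rm
    ... | inj₂ refl = ℤP.≤⇒≯ lv≤l₂ lm<lv

  module Unstraddled {v} (v-bad : Bad G₁ v) (v⊆s : v ⊆ᵢ s)
                     (flank : ∀ {m} → Max m → left v ≤ left m ⊎ right m ≤ right v) where

    prefix-bad : right v < right s → Bad G (left s , right v)
    prefix-bad rv<rs = bad⁺ {G} (ℤP.≤-<-trans (proj₁ v⊆s) (proj₁ v-bad)) cover
      where
      before-v : ∀ {k y} → k ∈ G ∣ s → y ∈ᵢ k → y < left v → k ∈ G ∣ (left s , right v)
      before-v k∈ (lk≤y , _) y<lv with ∈-∣⁻ {G} k∈
      ... | k∈G , k⊆s with maximal-above k∈G k⊆s
      ...   | m , max , k⊆m with flank max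
      ...     | inj₁ lv≤lm = ⊥-elim (ℤP.≤⇒≯ (ℤP.≤-trans lv≤lm (ℤP.≤-trans (proj₁ k⊆m) lk≤y)) y<lv)
      ...     | inj₂ rm≤rv = ∈-∣⁺ {G} k∈G (proj₁ k⊆s , ℤP.≤-trans (proj₂ k⊆m) rm≤rv)
      cover : ∀ y → y ∈ᵢ (left s , right v) → DoublyCovered (G ∣ (left s , right v)) y
      cover y (ls≤y , y<rv) with left v ≤? y
      ... | yes lv≤y =
        lift-cover ◁ (λ _ _ g⊆v → ⊆ᵢ-trans g⊆v (proj₁ v⊆s , ℤP.≤-refl))
                     (λ c (_ , r₁≤rv) → proj₁ (maximal⇒⊆ (max₁ c)) , r₁≤rv)
                     (bad⁻ {G₁} v-bad (lv≤y , y<rv))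
      ... | no lv≰y =
        covered-mono (λ k∈ y∈k → before-v k∈ y∈k (ℤP.≰⇒> lv≰y)) (cover-s (ls≤y , ℤP.<-trans y<rv rv<rs))

    suffix-bad : left s < left v → Bad G (left v , right s)
    suffix-bad ls<lv = bad⁺ {G} (ℤP.<-≤-trans (proj₁ v-bad) (proj₂ v⊆s)) cover
      where
      after-v : ∀ {k y} → k ∈ G ∣ s → y ∈ᵢ k → right v ≤ y → k ∈ G ∣ (left v , right s)
      after-v k∈ (_ , y<rk) rv≤y with ∈-∣⁻ {G} k∈
      ... | k∈G , k⊆s with maximal-above k∈G k⊆s
      ...   | m , max , k⊆m with flank max
      ...     | inj₁ lv≤lm = ∈-∣⁺ {G} k∈G (ℤP.≤-trans lv≤lm (proj₁ k⊆m) , proj₂ k⊆s)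
      ...     | inj₂ rm≤rv = ⊥-elim (ℤP.≤⇒≯ rv≤y (ℤP.<-≤-trans y<rk (ℤP.≤-trans (proj₂ k⊆m) rm≤rv)))
      cover : ∀ y → y ∈ᵢ (left v , right s) → DoublyCovered (G ∣ (left v , right s)) y
      cover y (lv≤y , y<rs) with y <? right v
      ... | yes y<rv =
        lift-cover ▷ (λ _ _ g⊆v → ⊆ᵢ-trans g⊆v (ℤP.≤-refl , proj₂ v⊆s))
                     (λ c (lv≤l₂ , _) → lv≤l₂ , proj₂ (maximal⇒⊆ (max₂ c)))
                     (bad⁻ {G₁} v-bad (lv≤y , y<rv))
      ... | no y≮rv =
        covered-mono (λ k∈ y∈k → after-v k∈ y∈k (ℤP.≮⇒≥ y≮rv)) (cover-s (ℤP.≤-trans (proj₁ v⊆s) lv≤y , y<rs))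

  -- If no maximal member straddles v, the part of s between its left end and the end of v
  -- (or between the start of v and its right end) is bad in G.
  proper-good₁ : ∀ {v} → v ⊆ᵢ s → v ≢ s → ¬ Bad G₁ v
  proper-good₁ {v} v⊆s v≢s v-bad
    with any? (λ m → maximal? m ×-dec (left m <? left v) ×-dec (right v <? right m)) G
  ... | yes straddle with find straddle
  ...   | m , _ , max , lm<lv , rv<rm = straddled-good₁ v⊆s v≢s max lm<lv rv<rm v-bad
  proper-good₁ {v} v⊆s@(ls≤lv , rv≤rs) v≢s v-bad | no no-straddle =
    shorter-side (right v <? right s) (left s <? left v)
    where
    flank : ∀ {m} → Max m → left v ≤ left m ⊎ right m ≤ right v
    flank {m} max with left v ≤? left m | right m ≤? right v
    ... | yes lv≤lm | _ = inj₁ lv≤lm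
    ... | no _ | yes rm≤rv = inj₂ rm≤rv
    ... | no lv≰lm | no rm≰rv =
      ⊥-elim (no-straddle (lose (maximal⇒∈ max) (max , ℤP.≰⇒> lv≰lm , ℤP.≰⇒> rm≰rv)))

    open Unstraddled v-bad v⊆s flank

    shorter-side : Dec (right v < right s) → Dec (left s < left v) → ⊥
    shorter-side (yes rv<rs) _ =
      proper-good (ℤP.≤-refl , ℤP.<⇒≤ rv<rs) (λ eq → ℤP.<-irrefl (cong right eq) rv<rs) (prefix-bad rv<rs)
    shorter-side (no _) (yes ls<lv) =
      proper-good (ℤP.<⇒≤ ls<lv , ℤP.≤-refl) (λ eq → ℤP.<-irrefl (cong left (sym eq)) ls<lv) (suffix-bad ls<lv)
    shorter-side (no rv≮rs) (no ls≮lv) =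
      v≢s (interval-≡ (ℤP.≤-antisym (ℤP.≮⇒≥ ls≮lv) ls≤lv) (ℤP.≤-antisym rv≤rs (ℤP.≮⇒≥ rv≮rs)))

  flush : ∀ {v} → ¬ (v ⊆ᵢ s × v ≢ s) → left v ≤ left s ⊎ right s ≤ right v
  flush {v} not-proper with left v ≤? left s | right s ≤? right v
  ... | yes lv≤ls | _ = inj₁ lv≤ls
  ... | no _ | yes rs≤rv = inj₂ rs≤rv
  ... | no lv≰ls | no rs≰rv =
    ⊥-elim (not-proper ((ℤP.<⇒≤ ls<lv , ℤP.<⇒≤ (ℤP.≰⇒> rs≰rv)) ,
                        λ eq → ℤP.<-irrefl (cong left (sym eq)) ls<lv))
    where ls<lv = ℤP.≰⇒> lv≰ls

  bad-reflect : ∀ {v} → Bad G₁ v → Bad G v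
  bad-reflect {v} v-bad with (v ⊆ᵢ? s) ×-dec ¬? (v ≟ᵢ s)
  ... | yes (v⊆s , v≢s) = ⊥-elim (proper-good₁ v⊆s v≢s v-bad)
  ... | no not-proper = bad⁺ {G} (proj₁ v-bad) λ _ y∈v → lift (flush not-proper) (bad⁻ {G₁} v-bad y∈v)
    where
    lift : ∀ {y} → left v ≤ left s ⊎ right s ≤ right v → DoublyCovered (G₁ ∣ v) y → DoublyCovered (G ∣ v) y
    lift (inj₁ lv≤ls) = lift-cover ◁ (λ _ _ g⊆v → g⊆v)
      (λ c (_ , r₁≤rv) → ℤP.≤-trans lv≤ls (proj₁ (maximal⇒⊆ (max₁ c))) , r₁≤rv)
    lift (inj₂ rs≤rv) = lift-cover ▷ (λ _ _ g⊆v → g⊆v)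
      (λ c (lv≤l₂ , _) → lv≤l₂ , ℤP.≤-trans (proj₂ (maximal⇒⊆ (max₂ c))) rs≤rv)

  reduce-differs : Differs G G₁ (λ j → count (below? G s j))
  reduce-differs .Differs.at i =
    second-difference (i ∈? G₁) (i ∈? G) (below? G s i)
      (below? G s (growˡ i)) (below? G s (growʳ i)) (below? G s (grow i))
      (below-mono {G} (⊆growˡ i)) (below-mono {G} (⊆growʳ i))
      (below-mono {G} (growˡ⊆grow i)) (below-mono {G} (growʳ⊆grow i))
      added created removed maximal
    where
    added : i ∈ G₁ → i ∉ G → Below G s (growˡ i) × Below G s (growʳ i) × ¬ Below G s (grow i)
    added i∈G₁ i∉G with origin i∈G₁
    ... | old i∈G _ = ⊥-elim (i∉G i∈G)
    ... | new c refl = junction-profile c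

    created : Below G s (growˡ i) → Below G s (growʳ i) → ¬ Below G s (grow i) → i ∈ G₁ × i ∉ G
    created belowˡ belowʳ no-grow with profile-junction belowˡ belowʳ no-grow
    ... | _ , _ , c , refl = new∈ c , overlap-∉ c

    removed : i ∈ G → i ∉ G₁ → Below G s i × ¬ Below G s (growˡ i) × ¬ Below G s (growʳ i)
    removed i∈G i∉G₁ with maximal? i
    ... | yes max = maximal-profile max
    ... | no ¬max = ⊥-elim (i∉G₁ (old∈ i∈G ¬max))

    maximal : Below G s i → ¬ Below G s (growˡ i) → ¬ Below G s (growʳ i) → i ∈ G × i ∉ G₁
    maximal below no-growˡ no-growʳ = maximal⇒∈ max , λ i∈G₁ → not-reduced (origin i∈G₁)
      where
      max = profile-maximal below no-growˡ no-growʳ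
      not-reduced : Origin i → ⊥
      not-reduced (old _ ¬max) = ¬max max
      not-reduced (new c refl) = no-growˡ (proj₁ (junction-profile c))

private
  crossing-good-≤ : ∀ {G s t x} → MinimalBad G s → MinimalBad G t → s ≢ t → left s ≤ left t →
                    x ∈ᵢ s → x ∈ᵢ t →
                    (∀ {g} → g ∈ G ∣ t → x ∈ᵢ g → g ⊆ᵢ s) →
                    (∀ {g} → g ∈ G ∣ s → x ∈ᵢ g → g ⊆ᵢ t) → ⊥
  crossing-good-≤ {G} {s} {t} {x} (s-bad , s-minimal) (t-bad , t-minimal) s≢t ls≤lt
                  (_ , x<rs) (lt≤x , x<rt) t∋x⇒⊆s s∋x⇒⊆t = s≢t s≡t
    where
    rs<rt : right s < right t
    rs<rt with right s <? right t
    ... | yes rs<rt = rs<rt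
    ... | no rs≮rt = ⊥-elim (s≢t (sym (s-minimal t t-bad (ls≤lt , ℤP.≮⇒≥ rs≮rt))))

    u : Interval
    u = (left t , right s)

    cover : ∀ y → y ∈ᵢ u → DoublyCovered (G ∣ u) y
    cover y (lt≤y , y<rs) with y ≤? x
    ... | yes y≤x = covered-mono into-u (bad⁻ {G} t-bad (lt≤y , ℤP.<-trans y<rs rs<rt))
      where
      into-u : ∀ {g} → g ∈ G ∣ t → y ∈ᵢ g → g ∈ G ∣ u
      into-u {g} g∈ (lg≤y , _) with ∈-∣⁻ {G} g∈ | x <? right g
      ... | g∈G , (lt≤lg , _) | yes x<rg =
        ∈-∣⁺ {G} g∈G (lt≤lg , proj₂ (t∋x⇒⊆s g∈ (ℤP.≤-trans lg≤y y≤x , x<rg)))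
      ... | g∈G , (lt≤lg , _) | no x≮rg =
        ∈-∣⁺ {G} g∈G (lt≤lg , ℤP.<⇒≤ (ℤP.≤-<-trans (ℤP.≮⇒≥ x≮rg) x<rs))
    ... | no y≰x = covered-mono into-u (bad⁻ {G} s-bad (ℤP.≤-trans ls≤lt lt≤y , y<rs))
      where
      into-u : ∀ {g} → g ∈ G ∣ s → y ∈ᵢ g → g ∈ G ∣ u
      into-u {g} g∈ (_ , y<rg) with ∈-∣⁻ {G} g∈ | left g ≤? x
      ... | g∈G , (_ , rg≤rs) | yes lg≤x =
        ∈-∣⁺ {G} g∈G (proj₁ (s∋x⇒⊆t g∈ (lg≤x , ℤP.<-trans (ℤP.≰⇒> y≰x) y<rg)) , rg≤rs)
      ... | g∈G , (_ , rg≤rs) | no lg≰x =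
        ∈-∣⁺ {G} g∈G (ℤP.<⇒≤ (ℤP.≤-<-trans lt≤x (ℤP.≰⇒> lg≰x)) , rg≤rs)

    s≡t : s ≡ t
    s≡t with s-minimal u (bad⁺ {G} (ℤP.≤-<-trans lt≤x x<rs) cover) (ls≤lt , ℤP.≤-refl)
    ... | u≡s = t-minimal s s-bad (ℤP.≤-reflexive (cong left u≡s) , ℤP.<⇒≤ rs<rt)

-- Otherwise s ∩ t would be bad, and minimality would force s = t.
crossing-good : ∀ {G s t x} → MinimalBad G s → MinimalBad G t → s ≢ t → x ∈ᵢ s → x ∈ᵢ t →
                (∀ {g} → g ∈ G ∣ t → x ∈ᵢ g → g ⊆ᵢ s) →
                (∀ {g} → g ∈ G ∣ s → x ∈ᵢ g → g ⊆ᵢ t) → ⊥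
crossing-good {G} {s} {t} s-min t-min s≢t x∈s x∈t t∋x⇒⊆s s∋x⇒⊆t with ℤP.≤-total (left s) (left t)
... | inj₁ ls≤lt = crossing-good-≤ {G} s-min t-min s≢t ls≤lt x∈s x∈t t∋x⇒⊆s s∋x⇒⊆t
... | inj₂ lt≤ls = crossing-good-≤ {G} t-min s-min (s≢t ∘ sym) lt≤ls x∈t x∈s s∋x⇒⊆t t∋x⇒⊆s

module Preservation (G : Family) (wf : WellFormed G) (s t : Interval)
                    (s-min : MinimalBad G s) (t-min : MinimalBad G t) (s≢t : s ≢ t)
                    (G₁ : Family) (red : IsReduce G s G₁) where

  open Reduction G wf s s-min G₁ red

  cover-t : ∀ {x} → x ∈ᵢ t → DoublyCovered (G ∣ t) x
  cover-t = bad⁻ {G} (proj₁ t-min)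

  -- Maximal members of G ∣ s through x are replaced by their junctions towards M.
  module Push {M x} (max-M : Max M) (M⊈t : ¬ M ⊆ᵢ t) (x∈M : x ∈ᵢ M) where

    data Image (h : Interval) : Interval → Set where
      same  : h ∈ G → ¬ Max h → Image h h
      moved : (A : Adjacent h M) → M ≢ h → Image h (junction A)

    image : ∀ {h} → h ∈ G ∣ t → ∃ (Image h)
    image {h} h∈ with ∈-∣⁻ {G} h∈ | maximal? h
    ... | h∈G , _ | no ¬max = h , same h∈G ¬max
    ... | _ , h⊆t | yes max = _ , moved (adjacent-exists max max-M (M≢h ∘ sym)) M≢h
      where
      M≢h : M ≢ h
      M≢h refl = M⊈t h⊆t

    image∈ : ∀ {h r} → h ⊆ᵢ t → Image h r → r ∈ G₁ ∣ t
    image∈ h⊆t (same h∈G ¬max) = ∈-∣⁺ {G₁} (old∈ h∈G ¬max) h⊆t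
    image∈ h⊆t (moved A _) = ∈-∣⁺ {G₁} (new∈ (Adjacent.consecutive A)) (⊆ᵢ-trans (junction-⊆ A) h⊆t)

    ∈image : ∀ {h r} → x ∈ᵢ h → Image h r → x ∈ᵢ r
    ∈image x∈h (same _ _) = x∈h
    ∈image x∈h (moved A _) = ∈-junction A x∈h x∈M

    image-injective : ∀ {h h' r r'} → Image h r → Image h' r' → h ≢ h' → r ≢ r'
    image-injective (same _ _) (same _ _) h≢h' = h≢h'
    image-injective (same h∈G _) (moved (adjacent c _) _) _ refl = overlap-∉ c h∈G
    image-injective (moved (adjacent c _) _) (same h'∈G _) _ refl = overlap-∉ c h'∈G
    image-injective (moved A M≢h) (moved A' M≢h') h≢h' = junction-injective max-M M≢h M≢h' h≢h' A A'

    push-cover : DoublyCovered (G ∣ t) x → DoublyCovered (G₁ ∣ t) x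
    push-cover (covered h∈ h'∈ x∈h x∈h' h≢h') with image h∈ | image h'∈
    ... | _ , i | _ , i' =
      covered (image∈ (proj₂ (∈-∣⁻ {G} h∈)) i) (image∈ (proj₂ (∈-∣⁻ {G} h'∈)) i')
              (∈image x∈h i) (∈image x∈h' i') (image-injective i i' h≢h')

  second-member : ∀ {x} → x ∈ᵢ s → (∀ {k} → k ∈ G ∣ s → x ∈ᵢ k → k ⊆ᵢ t) →
                  ∃[ r ] r ∈ G₁ ∣ t × x ∈ᵢ r × (r ⊆ᵢ s ⊎ r ∉ G)
  second-member {x} x∈s s∋x⇒⊆t with cover-s x∈s
  ... | covered {k} {k'} k∈ k'∈ x∈k x∈k' k≢k' = pick (maximal? k) (maximal? k')
    where
    kept : ∀ {k} → k ∈ G ∣ s → x ∈ᵢ k → ¬ Max k → k ∈ G₁ ∣ t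
    kept k∈ x∈k ¬max = ∈-∣⁺ {G₁} (old∈ (proj₁ (∈-∣⁻ {G} k∈)) ¬max) (s∋x⇒⊆t k∈ x∈k)

    pick : Dec (Max k) → Dec (Max k') → ∃[ r ] r ∈ G₁ ∣ t × x ∈ᵢ r × (r ⊆ᵢ s ⊎ r ∉ G)
    pick (no ¬max) _ = k , kept k∈ x∈k ¬max , x∈k , inj₁ (proj₂ (∈-∣⁻ {G} k∈))
    pick (yes _) (no ¬max') = k' , kept k'∈ x∈k' ¬max' , x∈k' , inj₁ (proj₂ (∈-∣⁻ {G} k'∈))
    pick (yes max) (yes max') =
      junction A , ∈-∣⁺ {G₁} (new∈ c) (⊆ᵢ-trans (junction-⊆ A) (s∋x⇒⊆t k∈ x∈k)) ,
      ∈-junction A x∈k x∈k' , inj₂ (overlap-∉ c)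
      where
      A = adjacent-exists max max' k≢k'
      c = Adjacent.consecutive A

  -- Off s the cover of x in G ∣ t survives. On s: if a member of G ∣ s through x leaves t, push the
  -- cover towards it; if a member of G ∣ t through x leaves s, it survives beside a second member
  -- from s; if neither, s and t cross in a bad interval.
  cover-t₁ : ∀ x → x ∈ᵢ t → DoublyCovered (G₁ ∣ t) x
  cover-t₁ x x∈t with x ∈ᵢ? s
  ... | no x∉s = covered-mono keep (cover-t x∈t)
    where
    keep : ∀ {h} → h ∈ G ∣ t → x ∈ᵢ h → h ∈ G₁ ∣ t
    keep h∈ x∈h with ∈-∣⁻ {G} h∈
    ... | h∈G , h⊆t = ∈-∣⁺ {G₁} (old∈ h∈G λ max → x∉s (∈ᵢ-mono x∈h (maximal⇒⊆ max))) h⊆t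
  ... | yes x∈s with any? (λ g → (x ∈ᵢ? g) ×-dec ¬? (g ⊆ᵢ? t)) (G ∣ s)
  ...   | yes leaves-t with find leaves-t
  ...     | g , g∈ , x∈g , g⊈t with maximal-above (proj₁ (∈-∣⁻ {G} g∈)) (proj₂ (∈-∣⁻ {G} g∈))
  ...       | M , max-M , g⊆M =
    Push.push-cover max-M (λ M⊆t → g⊈t (⊆ᵢ-trans g⊆M M⊆t)) (∈ᵢ-mono x∈g g⊆M) (cover-t x∈t)
  cover-t₁ x x∈t | yes x∈s | no stays-in-t with any? (λ g → (x ∈ᵢ? g) ×-dec ¬? (g ⊆ᵢ? s)) (G ∣ t)
  ... | no stays-in-s = ⊥-elim (crossing-good {G} s-min t-min s≢t x∈s x∈t
          (λ {g} g∈ x∈g → decidable-stable (g ⊆ᵢ? s) λ g⊈s → stays-in-s (lose g∈ (x∈g , g⊈s)))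
          (λ {g} g∈ x∈g → decidable-stable (g ⊆ᵢ? t) λ g⊈t → stays-in-t (lose g∈ (x∈g , g⊈t))))
  ... | yes leaves-s with find leaves-s
  ...   | g , g∈ , x∈g , g⊈s with ∈-∣⁻ {G} g∈
  ...     | g∈G , g⊆t
    with second-member x∈s (λ {k} k∈ x∈k →
           decidable-stable (k ⊆ᵢ? t) λ k⊈t → stays-in-t (lose k∈ (x∈k , k⊈t)))
  ...       | r , r∈ , x∈r , r-in-s-or-new =
    covered (∈-∣⁺ {G₁} (old∈ g∈G (g⊈s ∘ maximal⇒⊆)) g⊆t) r∈ x∈g x∈r (g≢r r-in-s-or-new)
    where
    g≢r : r ⊆ᵢ s ⊎ r ∉ G → g ≢ r
    g≢r (inj₁ r⊆s) refl = g⊈s r⊆s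
    g≢r (inj₂ r∉G) refl = r∉G g∈G

  minimalBad-preserved : MinimalBad G₁ t
  minimalBad-preserved =
    bad⁺ {G₁} (proj₁ (proj₁ t-min)) cover-t₁ , λ v v-bad v⊆t → proj₂ t-min v (bad-reflect v-bad) v⊆t

reduce-wellFormed : ∀ {G s G₁} → WellFormed G → MinimalBad G s → IsReduce G s G₁ → WellFormed G₁
reduce-wellFormed {G} {s} {G₁} wf s-min red = Reduction.wellFormed G wf s s-min G₁ red

reduce-minimalBad : ∀ {G s t G₁} → WellFormed G → MinimalBad G s → MinimalBad G t → s ≢ t →
                    IsReduce G s G₁ → MinimalBad G₁ t
reduce-minimalBad {G} {s} {t} {G₁} wf s-min t-min s≢t red =
  Preservation.minimalBad-preserved G wf s t s-min t-min s≢t G₁ red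

module Exchange (G : Family) (wf : WellFormed G) (s t : Interval)
                (s-min : MinimalBad G s) (t-min : MinimalBad G t) (s≢t : s ≢ t)
                (G₁ : Family) (red₁ : IsReduce G s G₁) (G₂ : Family) (red₂ : IsReduce G t G₂) where

  open Reduction G wf s s-min G₁ red₁
  module T = Reduction G wf t t-min G₂ red₂

  t⊈s : ¬ t ⊆ᵢ s
  t⊈s t⊆s = s≢t (sym (proj₂ s-min t (proj₁ t-min) t⊆s))

  below₁⇒below : ∀ {j} → Below G₁ t j → Below G t j
  below₁⇒below {j} (g , g∈ , j⊆g) with ∈-∣⁻ {G₁} g∈
  ... | g∈₁ , g⊆t with origin g∈₁
  ...   | old g∈G _ = g , ∈-∣⁺ {G} g∈G g⊆t , j⊆g
  ...   | new {m₁} {m₂} c refl with m₁ ⊆ᵢ? t | m₂ ⊆ᵢ? t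
  ...     | yes m₁⊆t | _ = m₁ , ∈-∣⁺ {G} (maximal⇒∈ (max₁ c)) m₁⊆t , ⊆ᵢ-trans j⊆g (overlap-⊆₁ c)
  ...     | no _ | yes m₂⊆t = m₂ , ∈-∣⁺ {G} (maximal⇒∈ (max₂ c)) m₂⊆t , ⊆ᵢ-trans j⊆g (overlap-⊆₂ c)
  ...     | no m₁⊈t | no m₂⊈t = ⊥-elim (t⊈s (ℤP.<⇒≤ (ℤP.≤-<-trans (proj₁ (maximal⇒⊆ (max₁ c))) l₁<lt) ,
                                             ℤP.<⇒≤ (ℤP.<-≤-trans rt<r₂ (proj₂ (maximal⇒⊆ (max₂ c))))))
    where
    l₁<lt : left m₁ < left t
    l₁<lt with left m₁ <? left t
    ... | yes l₁<lt = l₁<lt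
    ... | no l₁≮lt = ⊥-elim (m₁⊈t (ℤP.≮⇒≥ l₁≮lt , proj₂ g⊆t))
    rt<r₂ : right t < right m₂
    rt<r₂ with right t <? right m₂
    ... | yes rt<r₂ = rt<r₂
    ... | no rt≮r₂ = ⊥-elim (m₂⊈t (proj₁ g⊆t , ℤP.≮⇒≥ rt≮r₂))

  below-lost : ∀ {j} → Below G t j → ¬ Below G₁ t j → Below G s j × ¬ Below G₂ s j
  below-lost {j} (f , f∈ , j⊆f) not-below₁ = maximal-below max-f j⊆f , not-below₂
    where
    -- Members of G ∣ t above j must all be maximal in G ∣ s, and j must not lie below the junction
    -- of such a member with another maximal member; this rules out every member of G₂ ∣ s above j.
    forced-maximal : ∀ {h} → h ∈ G ∣ t → j ⊆ᵢ h → Max h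
    forced-maximal {h} h∈ j⊆h with maximal? h
    ... | yes max = max
    ... | no ¬max =
      ⊥-elim (not-below₁ (h , ∈-∣⁺ {G₁} (old∈ h∈G ¬max) h⊆t , j⊆h))
      where
      h∈G = proj₁ (∈-∣⁻ {G} h∈)
      h⊆t = proj₂ (∈-∣⁻ {G} h∈)

    max-f = forced-maximal f∈ j⊆f

    no-junction : ∀ {h m} → Max h → h ⊆ᵢ t → Max m → h ≢ m → j ⊆ᵢ h → j ⊆ᵢ m → ⊥
    no-junction max-h h⊆t max-m h≢m j⊆h j⊆m =
      not-below₁ (junction A , ∈-∣⁺ {G₁} (new∈ (Adjacent.consecutive A)) (⊆ᵢ-trans (junction-⊆ A) h⊆t) ,
                  ⊆-junction A j⊆h j⊆m)
      where A = adjacent-exists max-h max-m h≢m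

    not-below₂ : ¬ Below G₂ s j
    not-below₂ (g , g∈ , j⊆g) with ∈-∣⁻ {G₂} g∈
    ... | g∈₂ , g⊆s with T.origin g∈₂
    ...   | T.new c refl =
      no-junction (forced-maximal (proj₁ (T.max₁ c)) j⊆m₁) (T.maximal⇒⊆ (T.max₁ c))
                  (forced-maximal (proj₁ (T.max₂ c)) j⊆m₂) (T.distinct c) j⊆m₁ j⊆m₂
      where
      j⊆m₁ = ⊆ᵢ-trans j⊆g (T.overlap-⊆₁ c)
      j⊆m₂ = ⊆ᵢ-trans j⊆g (T.overlap-⊆₂ c)
    ...   | T.old g∈G ¬max-t with g ⊆ᵢ? t
    ...     | yes g⊆t = ¬max-t (g∈t , λ h h∈ g⊆h → proj₂ (forced-maximal g∈t j⊆g) h (in-s h∈ g⊆h) g⊆h)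
      where
      g∈t = ∈-∣⁺ {G} g∈G g⊆t
      in-s : ∀ {h} → h ∈ G ∣ t → g ⊆ᵢ h → h ∈ G ∣ s
      in-s h∈ g⊆h = proj₁ (forced-maximal h∈ (⊆ᵢ-trans j⊆g g⊆h))
    ...     | no g⊈t with maximal-above g∈G g⊆s
    ...       | M , max-M , g⊆M =
      no-junction max-f f⊆t max-M (λ { refl → g⊈t (⊆ᵢ-trans g⊆M f⊆t) }) j⊆f (⊆ᵢ-trans j⊆g g⊆M)
      where f⊆t = proj₂ (∈-∣⁻ {G} f∈)

diamond : ∀ {G s t G₁ G₂ A B} → WellFormed G → MinimalBad G s → MinimalBad G t → s ≢ t →
          IsReduce G s G₁ → IsReduce G t G₂ → IsReduce G₁ t A → IsReduce G₂ s B → A ≈F B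
diamond {G} {s} {t} {G₁} {G₂} {A} {B} wf s-min t-min s≢t red₁ red₂ redA redB =
  differs-unique (differs-resp exchange (differs-trans S.reduce-differs SA.reduce-differs))
                 (differs-trans T.reduce-differs TB.reduce-differs)
  where
  module S = Reduction G wf s s-min G₁ red₁
  module T = Reduction G wf t t-min G₂ red₂
  module SA = Reduction G₁ S.wellFormed t (reduce-minimalBad wf s-min t-min s≢t red₁) A redA
  module TB = Reduction G₂ T.wellFormed s (reduce-minimalBad wf t-min s-min (s≢t ∘ sym) red₂) B redB
  module ST = Exchange G wf s t s-min t-min s≢t G₁ red₁ G₂ red₂
  module TS = Exchange G wf t s t-min s-min (s≢t ∘ sym) G₂ red₂ G₁ red₁
  exchange : ∀ j → count (below? G s j) + count (below? G₁ t j) ≡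
                   count (below? G t j) + count (below? G₂ s j)
  exchange j = count-exchange (below? G s j) (below? G₂ s j) (below? G t j) (below? G₁ t j)
                 TS.below₁⇒below ST.below₁⇒below TS.below-lost ST.below-lost

run-from-alternative-step : ∀ {G ss H t G'} → WellFormed G → Run G ss H → MinimalBad G t → IsReduce G t G' →
          ∃[ ss' ] ∃[ H' ] Run G' ss' H' × (t ∷ ss') ↭ ss × H ≈F H'
run-from-alternative-step wf (stop no-bad) t-min _ = ⊥-elim (no-bad (_ , proj₁ t-min))
run-from-alternative-step {t = t} wf (step {s = s} s-min red run) t-min red' with s ≟ᵢ t
... | yes refl =
  let H' , run' , H≈H' = run-resp (isReduce-unique red red') run in _ , H' , run' , ↭-refl , H≈H'
run-from-alternative-step {t = t} {G'} wf (step {s = s} {G₁} s-min red run) t-min red' | no s≢t =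
  let ss₂ , H₂ , run₂ , perm , H≈H₂ =
        run-from-alternative-step (reduce-wellFormed wf s-min red) run
          (reduce-minimalBad wf s-min t-min s≢t red) (reduce-isReduce G₁ t)
      H₃ , run₃ , H₂≈H₃ =
        run-resp (diamond wf s-min t-min s≢t red red' (reduce-isReduce G₁ t) (reduce-isReduce G' s)) run₂
  in s ∷ ss₂ , H₃ ,
     step (reduce-minimalBad wf t-min s-min (s≢t ∘ sym) red') (reduce-isReduce G' s) run₃ ,
     ↭-trans (swap t s ↭-refl) (prep s perm) , ≈F-trans H≈H₂ H₂≈H₃

mainTheorem7 : (F : Family) → WellFormed F →
    ∀ {ss ss' : List Interval} {H H' : Family} →
    Run F ss H → Run F ss' H' →
    (H ≈F H') × (ss ↭ ss')
mainTheorem7 F wf (stop _) (stop _) = ≈F-refl , ↭-refl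
mainTheorem7 F wf (stop no-bad) (step s-min _ _) = ⊥-elim (no-bad (_ , proj₁ s-min))
mainTheorem7 F wf (step s-min _ _) (stop no-bad) = ⊥-elim (no-bad (_ , proj₁ s-min))
mainTheorem7 F wf (step {s = s} {G₁} s-min red run) run'@(step _ _ _) =
  let ss₁ , H₁ , run₁ , perm , H'≈H₁ = run-from-alternative-step wf run' s-min red
      H≈H₁ , ss↭ss₁ = mainTheorem7 G₁ (reduce-wellFormed wf s-min red) run run₁
  in ≈F-trans H≈H₁ (≈F-sym H'≈H₁) , ↭-trans (prep s ss↭ss₁) perm
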